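{- There are infinitely many isosceles trapezoids $ABCD$ with rational side lengths which are bicentric and whose ratio $N=R/r$ is a rational number.
   Context: A bicentric quadrilateral is a convex quadrilateral that has both a circumcircle (through all four vertices, radius $R$) and an incircle (tangent to all four sides, radius $r$). For a bicentric quadrilateral with sides $a,b,c,d$ in order and semiperimeter $s=a+c=b+d$, one has $R=\frac14\sqrt{\frac{(ab+cd)(ac+bd)(ad+bc)}{abcd}}$ and $r=\sqrt{abcd}/s$, so $N=R/r=\frac{s}{4abcd}\sqrt{(ab+cd)(ac+bd)(ad+bc)}$. -}

module Defs where

open import Data.Fin using (Fin)
open import Data.Fin.Patterns using (0F; 1F; 2F; 3F; 4F; 5F; 6F; 7F)

open import Data.Rational using (ℚ; 0ℚ; 1ℚ; _+_; _*_; _-_; _<_; _≤_)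
open import Data.Product using (Σ; _×_; ∃; ∃-syntax; _,_)
open import Data.Sum using (_⊎_)
open import Relation.Binary.PropositionalEquality using (_≡_; _≢_)

-- A quadrilateral ABCD recorded by its side lengths
-- a = AB, b = BC, c = CD, d = DA (in order).
record Quad : Set where
  constructor quad
  field
    a b c d : ℚ
open Quad public

-- ABCD is a (non-degenerate, strict) isosceles trapezoid with bases AB ∥ CD
-- and legs BC = DA.  Side lengths (a,b,c,b) with a ≠ c are realised by an
-- isosceles trapezoid (unique up to congruence) iff 2b > |a - c|.
record IsoscelesTrapezoid (q : Quad) : Set where
  field
    a-pos   : 0ℚ < a q
    b-pos   : 0ℚ < b q
    c-pos   : 0ℚ < c q
    d-pos   : 0ℚ < d q
    legs    : b q ≡ d q
    bases≢  : a q ≢ c q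
    exists₁ : a q - c q < b q + b q
    exists₂ : c q - a q < b q + b q

-- An isosceles trapezoid is always cyclic; it is tangential (hence bicentric)
-- iff Pitot's condition a + c = b + d holds.
Bicentric : Quad → Set
Bicentric q = a q + c q ≡ b q + d q

-- N = R/r = s/(4abcd) · sqrt((ab+cd)(ac+bd)(ad+bc)) is rational:
-- there is a rational N ≥ 0 with (4abcd·N)² = s²(ab+cd)(ac+bd)(ad+bc),
-- where s = a + c is the semiperimeter.
NRational : Quad → Set
NRational (quad a b c d) =
  ∃[ N ] (0ℚ ≤ N ×
    ((4ℚ * a * b * c * d * N) * (4ℚ * a * b * c * d * N)
      ≡ (a + c) * (a + c) * ((a * b + c * d) * (a * c + b * d) * (a * d + b * c))))
  where
    4ℚ : ℚ
    4ℚ = 1ℚ + 1ℚ + 1ℚ + 1ℚ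

relabel : Fin 8 → Quad → Quad
relabel 0F (quad a b c d) = quad a b c d
relabel 1F (quad a b c d) = quad b c d a
relabel 2F (quad a b c d) = quad c d a b
relabel 3F (quad a b c d) = quad d a b c
relabel 4F (quad a b c d) = quad d c b a
relabel 5F (quad a b c d) = quad c b a d
relabel 6F (quad a b c d) = quad b a d c
relabel 7F (quad a b c d) = quad a d c b

scale : ℚ → Quad → Quad
scale k (quad a b c d) = quad (k * a) (k * b) (k * c) (k * d)

-- Two isosceles trapezoids (determined up to congruence by their ordered side
-- lengths) are similar iff one side sequence is a positive multiple of a
-- dihedral relabelling of the other.
Similar : Quad → Quad → Set
Similar p q = ∃[ k ] ∃[ σ ] (0ℚ < k × q ≡ scale k (relabel σ p))

Good : Quad → Set
Good q = IsoscelesTrapezoid q × Bicentric q × NRational q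

{-# OPTIONS --safe #-}
module Submission where

-- With legs b = (a + c)/2 (Pitot's condition), the formula for N of an isosceles trapezoid
-- with bases a, c collapses to N = b √(ac + b²) / (ac), so N is rational as soon as ac + b²,
-- equivalently a² + 6ac + c², is a rational square. The line of slope −(n + 4) through (0, 1)
-- meets the conic y² = t² + 6t + 1 again at t = c/a = 2(n + 7) / ((n + 3)(n + 5)); this gives
-- the family A n = 2(n + 3)(n + 5), C n = 4(n + 7), B n = (A n + C n)/2 = n² + 10n + 29, with
-- A n · C n + (B n)² = (n² + 14n + 41)². Similar trapezoids of this shape have proportional
-- bases, and the ratio A n / C n is strictly increasing in n.

open import Defs
open import Data.Nat using (ℕ)
open import Data.Product using (Σ; _×_; _,_)
open import Relation.Binary.PropositionalEquality using (_≢_)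
open import Relation.Nullary using (¬_)

open import Algebra.Bundles using (Ring)
open import Data.Empty using (⊥; ⊥-elim)
open import Data.Fin.Patterns using (0F; 1F; 2F; 3F; 4F; 5F; 6F; 7F)
import Data.Nat as ℕ
import Data.Nat.Properties as ℕ
import Data.Nat.Tactic.RingSolver as ℕ-Solver
open import Data.Rational
  using (ℚ; 0ℚ; 1ℚ; _+_; _*_; _-_; 1/_; _<_; _≤_; NonZero; Positive; NonNegative; positive; nonNegative)
import Data.Rational.Properties as ℚ
open import Level using (0ℓ)
open import Relation.Binary.Definitions using (tri<; tri≈; tri>)
open import Relation.Binary.PropositionalEquality
  using (_≡_; refl; sym; trans; cong; cong₂; subst; module ≡-Reasoning)
open import Relation.Nullary.Decidable using (dec⇒maybe)
open import Tactic.RingSolver using (solve-∀)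
open import Tactic.RingSolver.Core.AlmostCommutativeRing using (AlmostCommutativeRing; fromCommutativeRing)
open import Algebra.Properties.Semiring.Mult (Ring.semiring ℚ.+-*-ring)
  using (×-homo-+; ×1-homo-*) renaming (_×_ to _×ℚ_)

ℚ-ring : AlmostCommutativeRing 0ℓ 0ℓ
ℚ-ring = fromCommutativeRing ℚ.+-*-commutativeRing (λ x → dec⇒maybe (0ℚ ℚ.≟ x))

0<1 : 0ℚ < 1ℚ
0<1 = ℚ.positive⁻¹ 1ℚ

p-q<p+q : ∀ p {q} → 0ℚ < q → p - q < p + q
p-q<p+q p 0<q = ℚ.+-monoʳ-< p (ℚ.<-trans (ℚ.neg-antimono-< 0<q) 0<q)

tangential⇒isoscelesTrapezoid : ∀ {a b c} → 0ℚ < b → 0ℚ < c → c < a → a + c ≡ b + b →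
                                IsoscelesTrapezoid (quad a b c b)
tangential⇒isoscelesTrapezoid {a} {b} {c} 0<b 0<c c<a a+c≡b+b = record
  { a-pos   = 0<a
  ; b-pos   = 0<b
  ; c-pos   = 0<c
  ; d-pos   = 0<b
  ; legs    = refl
  ; bases≢  = λ a≡c → ℚ.<-irrefl (sym a≡c) c<a
  ; exists₁ = subst (a - c <_) a+c≡b+b (p-q<p+q a 0<c)
  ; exists₂ = subst (c - a <_) (trans (ℚ.+-comm c a) a+c≡b+b) (p-q<p+q c 0<a)
  }
  where
  0<a : 0ℚ < a
  0<a = ℚ.<-trans 0<c c<a

tangential⇒nRational : ∀ {a b c w} → 0ℚ < a → 0ℚ < b → 0ℚ < c → 0ℚ ≤ w →
                       a + c ≡ b + b → w * w ≡ a * c + b * b → NRational (quad a b c b)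
tangential⇒nRational {a} {b} {c} {w} 0<a 0<b 0<c 0≤w a+c≡b+b w²≡ac+b² = N , 0≤N , (begin
  (4ℚ * a * b * c * b * N) * (4ℚ * a * b * c * b * N)
    ≡⟨ cong₂ _*_ 4abcbN≡4b³w 4abcbN≡4b³w ⟩
  (4ℚ * (b * b * b) * w) * (4ℚ * (b * b * b) * w)
    ≡⟨ square-4b³w b w ⟩
  (b + b) * (b + b) * (b + b) * (b + b) * (b * b) * (w * w)
    ≡⟨ cong₂ (λ s v → s * s * s * s * (b * b) * v) (sym a+c≡b+b) w²≡ac+b² ⟩
  (a + c) * (a + c) * (a + c) * (a + c) * (b * b) * (a * c + b * b)
    ≡⟨ equalLegs-product a b c ⟩
  (a + c) * (a + c) * ((a * b + c * b) * (a * c + b * b) * (a * b + b * c)) ∎)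
  where
  open ≡-Reasoning

  4ℚ : ℚ
  4ℚ = 1ℚ + 1ℚ + 1ℚ + 1ℚ

  instance
    ac>0 : Positive (a * c)
    ac>0 = ℚ.pos*pos⇒pos a {{positive 0<a}} c {{positive 0<c}}
    ac≢0 : NonZero (a * c)
    ac≢0 = ℚ.pos⇒nonZero (a * c)

  N : ℚ
  N = b * w * 1/ (a * c)

  0≤N : 0ℚ ≤ N
  0≤N = ℚ.nonNegative⁻¹ N {{ℚ.nonNeg*nonNeg⇒nonNeg (b * w) {{bw≥0}} (1/ (a * c)) {{1/ac≥0}}}}
    where
    bw≥0 : NonNegative (b * w)
    bw≥0 = ℚ.nonNeg*nonNeg⇒nonNeg b {{nonNegative (ℚ.<⇒≤ 0<b)}} w {{nonNegative 0≤w}}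
    1/ac≥0 : NonNegative (1/ (a * c))
    1/ac≥0 = ℚ.pos⇒nonNeg (1/ (a * c)) {{ℚ.1/pos⇒pos (a * c)}}

  regroup : ∀ a b c w i → 4ℚ * a * b * c * b * (b * w * i) ≡ a * c * i * (4ℚ * (b * b * b) * w)
  regroup = solve-∀ ℚ-ring

  square-4b³w : ∀ b w → (4ℚ * (b * b * b) * w) * (4ℚ * (b * b * b) * w)
                      ≡ (b + b) * (b + b) * (b + b) * (b + b) * (b * b) * (w * w)
  square-4b³w = solve-∀ ℚ-ring

  equalLegs-product : ∀ a b c → (a + c) * (a + c) * (a + c) * (a + c) * (b * b) * (a * c + b * b)
                              ≡ (a + c) * (a + c) * ((a * b + c * b) * (a * c + b * b) * (a * b + b * c))
  equalLegs-product = solve-∀ ℚ-ring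

  4abcbN≡4b³w : 4ℚ * a * b * c * b * N ≡ 4ℚ * (b * b * b) * w
  4abcbN≡4b³w = begin
    4ℚ * a * b * c * b * N                       ≡⟨ regroup a b c w (1/ (a * c)) ⟩
    a * c * 1/ (a * c) * (4ℚ * (b * b * b) * w) ≡⟨ cong (_* (4ℚ * (b * b * b) * w)) (ℚ.*-inverseʳ (a * c)) ⟩
    1ℚ * (4ℚ * (b * b * b) * w)                  ≡⟨ ℚ.*-identityˡ _ ⟩
    4ℚ * (b * b * b) * w                         ∎

similar⇒crossRatio≡ : ∀ {a b c a′ b′ c′} → c < a → c′ < a′ →
                      Similar (quad a b c b) (quad a′ b′ c′ b′) → a * c′ ≡ a′ * c
similar⇒crossRatio≡ {a} {b} {c} {a′} {b′} {c′} c<a c′<a′ (k , σ , 0<k , eq) = byRelabelling σ eq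
  where
  instance
    k>0 : Positive k
    k>0 = positive 0<k

  proportional : a′ ≡ k * a → c′ ≡ k * c → a * c′ ≡ a′ * c
  proportional refl refl = trans (sym (ℚ.*-assoc a k c)) (cong (_* c) (ℚ.*-comm a k))

  reversed : a′ ≡ k * c → c′ ≡ k * a → ⊥
  reversed refl refl = ℚ.<-asym c′<a′ (ℚ.*-monoʳ-<-pos k c<a)

  legsAsBases : a′ ≡ k * b → c′ ≡ k * b → ⊥
  legsAsBases refl refl = ℚ.<-irrefl refl c′<a′

  byRelabelling : ∀ σ → quad a′ b′ c′ b′ ≡ scale k (relabel σ (quad a b c b)) → a * c′ ≡ a′ * c
  byRelabelling 0F eq = proportional (cong Quad.a eq) (cong Quad.c eq)
  byRelabelling 7F eq = proportional (cong Quad.a eq) (cong Quad.c eq)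
  byRelabelling 2F eq = ⊥-elim (reversed (cong Quad.a eq) (cong Quad.c eq))
  byRelabelling 5F eq = ⊥-elim (reversed (cong Quad.a eq) (cong Quad.c eq))
  byRelabelling 1F eq = ⊥-elim (legsAsBases (cong Quad.a eq) (cong Quad.c eq))
  byRelabelling 3F eq = ⊥-elim (legsAsBases (cong Quad.a eq) (cong Quad.c eq))
  byRelabelling 4F eq = ⊥-elim (legsAsBases (cong Quad.a eq) (cong Quad.c eq))
  byRelabelling 6F eq = ⊥-elim (legsAsBases (cong Quad.a eq) (cong Quad.c eq))

fromℕ : ℕ → ℚ
fromℕ n = n ×ℚ 1ℚ

fromℕ-+ : ∀ m n → fromℕ (m ℕ.+ n) ≡ fromℕ m + fromℕ n
fromℕ-+ = ×-homo-+ 1ℚ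

fromℕ-* : ∀ m n → fromℕ (m ℕ.* n) ≡ fromℕ m * fromℕ n
fromℕ-* = ×1-homo-*

0≤fromℕ : ∀ n → 0ℚ ≤ fromℕ n
0≤fromℕ ℕ.zero    = ℚ.≤-refl
0≤fromℕ (ℕ.suc n) = ℚ.+-mono-≤ (ℚ.<⇒≤ 0<1) (0≤fromℕ n)

0<fromℕ : ∀ n .{{_ : ℕ.NonZero n}} → 0ℚ < fromℕ n
0<fromℕ (ℕ.suc n) = ℚ.+-mono-<-≤ 0<1 (0≤fromℕ n)

fromℕ-mono-< : ∀ {m n} → m ℕ.< n → fromℕ m < fromℕ n
fromℕ-mono-< {ℕ.zero}  {ℕ.suc n} _ = 0<fromℕ (ℕ.suc n)
fromℕ-mono-< {ℕ.suc _} (ℕ.s<s m<n) = ℚ.+-monoʳ-< 1ℚ (fromℕ-mono-< m<n)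

fromℕ-injective : ∀ {m n} → fromℕ m ≡ fromℕ n → m ≡ n
fromℕ-injective {m} {n} eq with ℕ.<-cmp m n
... | tri< m<n _ _ = ⊥-elim (ℚ.<-irrefl eq (fromℕ-mono-< m<n))
... | tri≈ _ m≡n _ = m≡n
... | tri> _ _ n<m = ⊥-elim (ℚ.<-irrefl (sym eq) (fromℕ-mono-< n<m))

A B C W : ℕ → ℕ
A n = 30 ℕ.+ 16 ℕ.* n ℕ.+ 2 ℕ.* (n ℕ.* n)
B n = 29 ℕ.+ 10 ℕ.* n ℕ.+ n ℕ.* n
C n = 28 ℕ.+ 4 ℕ.* n
W n = 41 ℕ.+ 14 ℕ.* n ℕ.+ n ℕ.* n

-- The reflective solver does not unfold A, B, C, W, so each identity is solved
-- on the polynomials written out.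

A+C≡B+B : ∀ n → A n ℕ.+ C n ≡ B n ℕ.+ B n
A+C≡B+B = identity
  where
  identity : ∀ n → 30 ℕ.+ 16 ℕ.* n ℕ.+ 2 ℕ.* (n ℕ.* n) ℕ.+ (28 ℕ.+ 4 ℕ.* n)
                 ≡ 29 ℕ.+ 10 ℕ.* n ℕ.+ n ℕ.* n ℕ.+ (29 ℕ.+ 10 ℕ.* n ℕ.+ n ℕ.* n)
  identity = ℕ-Solver.solve-∀

W²≡AC+B² : ∀ n → W n ℕ.* W n ≡ A n ℕ.* C n ℕ.+ B n ℕ.* B n
W²≡AC+B² = identity
  where
  identity : ∀ n → (41 ℕ.+ 14 ℕ.* n ℕ.+ n ℕ.* n) ℕ.* (41 ℕ.+ 14 ℕ.* n ℕ.+ n ℕ.* n)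
                 ≡ (30 ℕ.+ 16 ℕ.* n ℕ.+ 2 ℕ.* (n ℕ.* n)) ℕ.* (28 ℕ.+ 4 ℕ.* n)
                   ℕ.+ (29 ℕ.+ 10 ℕ.* n ℕ.+ n ℕ.* n) ℕ.* (29 ℕ.+ 10 ℕ.* n ℕ.+ n ℕ.* n)
  identity = ℕ-Solver.solve-∀

C<A : ∀ n → C n ℕ.< A n
C<A n = subst (C n ℕ.<_) (sym (A≡C+ n)) (ℕ.m<m+n (C n) ℕ.z<s)
  where
  A≡C+ : ∀ n → 30 ℕ.+ 16 ℕ.* n ℕ.+ 2 ℕ.* (n ℕ.* n)
             ≡ 28 ℕ.+ 4 ℕ.* n ℕ.+ (2 ℕ.+ 12 ℕ.* n ℕ.+ 2 ℕ.* (n ℕ.* n))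
  A≡C+ = ℕ-Solver.solve-∀

-- A m C n − A n C m = (m − n) D m n, stated with both sides moved so that no subtraction occurs.
D : ℕ → ℕ → ℕ
D m n = 8 ℕ.* (41 ℕ.+ 7 ℕ.* (m ℕ.+ n) ℕ.+ m ℕ.* n)

crossRatio-identity : ∀ m n → A m ℕ.* C n ℕ.+ n ℕ.* D m n ≡ A n ℕ.* C m ℕ.+ m ℕ.* D m n
crossRatio-identity = identity
  where
  identity : ∀ m n → (30 ℕ.+ 16 ℕ.* m ℕ.+ 2 ℕ.* (m ℕ.* m)) ℕ.* (28 ℕ.+ 4 ℕ.* n)
                     ℕ.+ n ℕ.* (8 ℕ.* (41 ℕ.+ 7 ℕ.* (m ℕ.+ n) ℕ.+ m ℕ.* n))
                   ≡ (30 ℕ.+ 16 ℕ.* n ℕ.+ 2 ℕ.* (n ℕ.* n)) ℕ.* (28 ℕ.+ 4 ℕ.* m)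
                     ℕ.+ m ℕ.* (8 ℕ.* (41 ℕ.+ 7 ℕ.* (m ℕ.+ n) ℕ.+ m ℕ.* n))
  identity = ℕ-Solver.solve-∀

crossRatio-injective : ∀ {m n} → A m ℕ.* C n ≡ A n ℕ.* C m → m ≡ n
crossRatio-injective {m} {n} eq = sym (ℕ.*-cancelʳ-≡ n m (D m n) (ℕ.+-cancelˡ-≡ (A n ℕ.* C m) _ _ (begin
  A n ℕ.* C m ℕ.+ n ℕ.* D m n ≡⟨ cong (ℕ._+ n ℕ.* D m n) eq ⟨
  A m ℕ.* C n ℕ.+ n ℕ.* D m n ≡⟨ crossRatio-identity m n ⟩
  A n ℕ.* C m ℕ.+ m ℕ.* D m n ∎)))
  where open ≡-Reasoning

trapezoid : ℕ → Quad
trapezoid n = quad (fromℕ (A n)) (fromℕ (B n)) (fromℕ (C n)) (fromℕ (B n))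

trapezoid-C<A : ∀ n → fromℕ (C n) < fromℕ (A n)
trapezoid-C<A n = fromℕ-mono-< (C<A n)

trapezoid-A+C≡B+B : ∀ n → fromℕ (A n) + fromℕ (C n) ≡ fromℕ (B n) + fromℕ (B n)
trapezoid-A+C≡B+B n = begin
  fromℕ (A n) + fromℕ (C n)   ≡⟨ fromℕ-+ (A n) (C n) ⟨
  fromℕ (A n ℕ.+ C n)         ≡⟨ cong fromℕ (A+C≡B+B n) ⟩
  fromℕ (B n ℕ.+ B n)         ≡⟨ fromℕ-+ (B n) (B n) ⟩
  fromℕ (B n) + fromℕ (B n)   ∎
  where open ≡-Reasoning

trapezoid-W²≡AC+B² : ∀ n → fromℕ (W n) * fromℕ (W n) ≡ fromℕ (A n) * fromℕ (C n) + fromℕ (B n) * fromℕ (B n)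
trapezoid-W²≡AC+B² n = begin
  fromℕ (W n) * fromℕ (W n)                              ≡⟨ fromℕ-* (W n) (W n) ⟨
  fromℕ (W n ℕ.* W n)                                    ≡⟨ cong fromℕ (W²≡AC+B² n) ⟩
  fromℕ (A n ℕ.* C n ℕ.+ B n ℕ.* B n)                    ≡⟨ fromℕ-+ (A n ℕ.* C n) (B n ℕ.* B n) ⟩
  fromℕ (A n ℕ.* C n) + fromℕ (B n ℕ.* B n)              ≡⟨ cong₂ _+_ (fromℕ-* (A n) (C n)) (fromℕ-* (B n) (B n)) ⟩
  fromℕ (A n) * fromℕ (C n) + fromℕ (B n) * fromℕ (B n)  ∎
  where open ≡-Reasoning

trapezoid-good : ∀ n → Good (trapezoid n)
trapezoid-good n =
  tangential⇒isoscelesTrapezoid (0<fromℕ (B n)) (0<fromℕ (C n)) (trapezoid-C<A n) (trapezoid-A+C≡B+B n) ,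
  trapezoid-A+C≡B+B n ,
  tangential⇒nRational (0<fromℕ (A n)) (0<fromℕ (B n)) (0<fromℕ (C n)) (0≤fromℕ (W n))
                       (trapezoid-A+C≡B+B n) (trapezoid-W²≡AC+B² n)

trapezoid-nonSimilar : ∀ m n → m ≢ n → ¬ Similar (trapezoid m) (trapezoid n)
trapezoid-nonSimilar m n m≢n sim = m≢n (crossRatio-injective (fromℕ-injective (begin
  fromℕ (A m ℕ.* C n)         ≡⟨ fromℕ-* (A m) (C n) ⟩
  fromℕ (A m) * fromℕ (C n)   ≡⟨ similar⇒crossRatio≡ (trapezoid-C<A m) (trapezoid-C<A n) sim ⟩
  fromℕ (A n) * fromℕ (C m)   ≡⟨ fromℕ-* (A n) (C m) ⟨
  fromℕ (A n ℕ.* C m)         ∎)))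
  where open ≡-Reasoning

proposition1p1 : Σ (ℕ → Quad) λ f → (((n : ℕ) → Good (f n))
                   × (∀ (m n : ℕ) → m ≢ n → ¬ Similar (f m) (f n)))
proposition1p1 = trapezoid , trapezoid-good , trapezoid-nonSimilar
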